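{- Let $n\ge 1$, let $N=\{1,\ldots,n\}$, and let $S_n$ be the symmetric group acting on $N$, with Coxeter generating set $S=\{s_1,\ldots,s_{n-1}\}$, where $s_i=(i,i+1)$. Let $J,K\subseteq S$. Let the ordered presentation of the graph $\mathcal{J}$ of $J$ be $(\mathcal{J}_1,\ldots,\mathcal{J}_r)$ and that of the graph $\mathcal{K}$ of $K$ be $(\mathcal{K}_1,\ldots,\mathcal{K}_s)$. Let $x\in X_J^{ -1}\cap X_K$. Then the ordered presentation of the graph $x^{ -1}\mathcal{J}\cap\mathcal{K}$ is the list $$(x^{ -1}\mathcal{J}_1\cap\mathcal{K}_1,\ x^{ -1}\mathcal{J}_2\cap\mathcal{K}_1,\ \ldots,\ x^{ -1}\mathcal{J}_r\cap\mathcal{K}_1,\ x^{ -1}\mathcal{J}_1\cap\mathcal{K}_2,\ \ldots,\ x^{ -1}\mathcal{J}_r\cap\mathcal{K}_2,\ \ldots,\ x^{ -1}\mathcal{J}_1\cap\mathcal{K}_s,\ \ldots,\ x^{ -1}\mathcal{J}_r\cap\mathcal{K}_s)$$ with the empty sets removed. That is, the nonempty sets $x^{ -1}\mathcal{J}_q\cap\mathcal{K}_m$ are exactly the vertex sets of the connected components of $x^{ -1}\mathcal{J}\cap\mathcal{K}$, and in the list above every element of each set is smaller than every element of each set appearing later in the list.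
   Context: Permutations act on the left, and products are composition of maps. For $J\subseteq S$, $W_J$ is the subgroup of $S_n$ generated by $J$, and $X_J$ is the set of minimal-length left coset representatives of $W_J$ in $S_n$ (length meaning Coxeter length with respect to $S$, which equals the number of inversions). $X_J^{ -1}=\{x^{ -1}: x\in X_J\}$ is then the set of minimal-length right coset representatives of $W_J$. The graph $\mathcal{J}$ of $J\subseteq S$ is the graph with vertex set $N$ and edge set $\{(i,i+1): s_i=(i,i+1)\in J\}$. If this graph has $r$ connected components, their vertex sets, listed in increasing order of their least elements, form the ordered presentation $(\mathcal{J}_1,\ldots,\mathcal{J}_r)$ of $\mathcal{J}$. Thus $1\in\mathcal{J}_1$, and whenever $u\in\mathcal{J}_i$, $v\in\mathcal{J}_j$ and $i<j$, we have $u<v$. The ordered presentation of an arbitrary graph on vertex set $N$ is defined in the same way. For a permutation $y$ and a graph $\mathcal{G}$ on $N$, $y\mathcal{G}$ is the graph on $N$ in which $(y(i),y(j))$ is an edge if and only if $(i,j)$ is an edge of $\mathcal{G}$. For a set of vertices $A$, $yA=\{y(a): a\in A\}$. For graphs $\mathcal{G},\mathcal{H}$ on $N$, $\mathcal{G}\cap\mathcal{H}$ is the graph on $N$ whose edges are those lying in both $\mathcal{G}$ and $\mathcal{H}$. For vertex sets, $\cap$ denotes ordinary set intersection. -}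

module Defs where

open import Data.Nat as ℕ using (ℕ; suc)
open import Data.Fin as Fin using (Fin; inject₁)
open import Data.Fin.Properties using (_<?_)
open import Data.Fin.Permutation using (Permutation′; transpose; flip; _⟨$⟩ʳ_; _⟨$⟩ˡ_)
open import Data.Fin.Subset using (Subset; _∈_; _∩_)
open import Data.Fin.Subset.Properties using (nonempty?)
open import Data.Vec using (tabulate; lookup)
open import Data.List using (List; length; filter; cartesianProduct; allFin; concatMap; map)
open import Data.List.Relation.Unary.All using (All)
open import Data.List.Relation.Unary.AllPairs using (AllPairs)
import Data.List.Membership.Propositional as LM
open import Data.Product using (Σ; ∃; _×_; _,_)
open import Data.Sum using (_⊎_)
open import Relation.Binary.PropositionalEquality using (_≡_)
open import Relation.Binary.Construct.Closure.ReflexiveTransitive using (Star)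
open import Relation.Nullary.Decidable using (_×-dec_)
open import Level using (0ℓ)

-- Vertex set N = {1,…,n} is modelled as Fin n (0-indexed), with n = suc m (n ≥ 1).
-- The Coxeter generators s_1,…,s_{n-1} are indexed by Fin m:
-- generator i : Fin m is the transposition swapping inject₁ i and suc i.

gen : ∀ {m} → Fin m → Fin (suc m) → Fin (suc m)
gen i = transpose (inject₁ i) (Fin.suc i) ⟨$⟩ʳ_

-- Coxeter length = number of inversions (as stated in the context):
-- number of pairs i < j with f j < f i.
len : ∀ {n} → (Fin n → Fin n) → ℕ
len {n} f = length (filter (λ p → (Data.Product.proj₁ p <? Data.Product.proj₂ p)
                                   ×-dec (f (Data.Product.proj₂ p) <? f (Data.Product.proj₁ p)))
                           (cartesianProduct (allFin n) (allFin n)))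

-- W_J: subgroup generated by J.  Since the generators are involutions in a
-- finite group, it consists of the (possibly empty) products of elements of J.
-- Products are composition of maps (left action).
data InW {m} (J : Subset m) : (Fin (suc m) → Fin (suc m)) → Set where
  idW   : InW J (λ a → a)
  stepW : ∀ {w} (i : Fin m) → i ∈ J → InW J w → InW J (λ a → gen i (w a))

InX : ∀ {m} → Subset m → Permutation′ (suc m) → Set
InX J x = ∀ w → InW J w → len (x ⟨$⟩ʳ_) ℕ.≤ len (λ a → x ⟨$⟩ʳ (w a))

InXinv : ∀ {m} → Subset m → Permutation′ (suc m) → Set
InXinv J x = InX J (flip x)

Graph : ℕ → Set₁
Graph n = Fin n → Fin n → Set

graphOf : ∀ {m} → Subset m → Graph (suc m)
graphOf J a b = ∃ λ i → i ∈ J ×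
  ((a ≡ inject₁ i × b ≡ Fin.suc i) ⊎ (a ≡ Fin.suc i × b ≡ inject₁ i))

actG : ∀ {n} → Permutation′ n → Graph n → Graph n
actG y G a b = G (y ⟨$⟩ˡ a) (y ⟨$⟩ˡ b)

actS : ∀ {n} → Permutation′ n → Subset n → Subset n
actS y A = tabulate (λ v → lookup A (y ⟨$⟩ˡ v))

_∩G_ : ∀ {n} → Graph n → Graph n → Graph n
(G ∩G H) a b = G a b × H a b

Adj : ∀ {n} → Graph n → Fin n → Fin n → Set
Adj G a b = G a b ⊎ G b a

Connected : ∀ {n} → Graph n → Fin n → Fin n → Set
Connected G = Star (Adj G)

IsComponent : ∀ {n} → Graph n → Subset n → Set
IsComponent G C = ∃ λ v → v ∈ C × (∀ u → (u ∈ C → Connected G v u) × (Connected G v u → u ∈ C))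

IsLeast : ∀ {n} → Fin n → Subset n → Set
IsLeast a A = a ∈ A × (∀ b → b ∈ A → a Fin.≤ b)

LeastBefore : ∀ {n} → Subset n → Subset n → Set
LeastBefore A B = ∃ λ a → ∃ λ b → IsLeast a A × IsLeast b B × a Fin.< b

IsOrderedPresentation : ∀ {n} → Graph n → List (Subset n) → Set
IsOrderedPresentation G L =
  All (IsComponent G) L × (∀ C → IsComponent G C → C LM.∈ L) × AllPairs LeastBefore L

AllBefore : ∀ {n} → Subset n → Subset n → Set
AllBefore A B = ∀ a b → a ∈ A → b ∈ B → a Fin.< b

intersectionList : ∀ {n} → Permutation′ n → List (Subset n) → List (Subset n) → List (Subset n)
intersectionList x Js Ks =
  filter nonempty? (concatMap (λ K → map (λ Jq → actS (flip x) Jq ∩ K) Js) Ks)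

-- A minimal coset representative x ∈ X_K satisfies x(i) < x(i+1) for every s_i ∈ K, since otherwise
-- x s_i would have fewer inversions; likewise x⁻¹ ∈ X_J is increasing along the edges of 𝒥. The
-- components of 𝒥 and 𝒦 are the intervals between consecutive missing edges, so x is increasing on
-- each 𝒦_m and x⁻¹ on each 𝒥_q. Now let u ≤ w lie in one 𝒦_m with x u and x w in one 𝒥_q. For
-- u ≤ i < w the values x i < x (i+1) lie between x u and x w, hence in 𝒥_q, and as x⁻¹ is increasing
-- on 𝒥_q and maps them to the consecutive i, i+1, they are neighbours: (x i, x (i+1)) is an edge of 𝒥.
-- So u and w are joined in x⁻¹𝒥 ∩ 𝒦, whose components are therefore exactly the nonempty
-- x⁻¹𝒥_q ∩ 𝒦_m. They come in the listed order because the 𝒦_m do, and because within one 𝒦_m the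
-- increasing map x carries the order of the 𝒥_q back to the sets x⁻¹𝒥_q ∩ 𝒦_m.
module Submission where

open import Defs
open import Level using (0ℓ)
open import Function using (_∘_; id; Injection)
open import Function.Properties.Inverse using (↔⇒↣)
open import Data.Empty using (⊥-elim)
open import Data.Bool using (Bool; true)
open import Data.Product using (∃; _×_; _,_; proj₁; proj₂)
open import Data.Sum as Sum using (_⊎_; inj₁; inj₂)
open import Data.Nat as ℕ using (ℕ; zero; suc; z≤n; s≤s)
import Data.Nat.Properties as ℕ
open import Data.Nat.ListAction using (sum)
open import Data.Nat.ListAction.Properties using (sum-++)
open import Algebra.Properties.CommutativeMonoid.Sum ℕ.+-0-commutativeMonoid
  using (sum-syntax; sum-permute; sum-cong-≗) renaming (sum to ∑)
open import Data.Fin as Fin using (Fin; inject₁; toℕ; _<_; _≤_)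
import Data.Fin.Properties as Fin
open import Data.Fin.Permutation using (Permutation′; transpose; flip; _⟨$⟩ʳ_; _⟨$⟩ˡ_; inverseˡ)
open import Data.Fin.Subset using (Subset; _∈_; _∉_; _∩_; Nonempty; inside; outside)
open import Data.Fin.Subset.Properties using (_∈?_; ⊆-antisym; x∈p∩q⁺; x∈p∩q⁻; nonempty?)
import Data.Vec as Vec
open import Data.Vec using (_∷_; here; there)
open import Data.Vec.Properties using (lookup∘tabulate; lookup⇒[]=; []=⇒lookup)
open import Data.List as List
  using (List; []; _∷_; filter; length; cartesianProduct; allFin; map; _++_; tabulate)
import Data.List.Properties as List
import Data.List.Membership.Propositional as List
import Data.List.Membership.Propositional.Properties as List
import Data.List.Relation.Unary.Any as Any
open import Data.List.Relation.Unary.All as All using (All; []; _∷_)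
import Data.List.Relation.Unary.All.Properties as All
open import Data.List.Relation.Unary.AllPairs as AllPairs using (AllPairs; []; _∷_)
import Data.List.Relation.Unary.AllPairs.Properties as AllPairs
open import Relation.Nullary using (Dec; yes; no; ¬_; does; proof)
open import Relation.Nullary.Decidable using (dec-true; _×-dec_; _→-dec_; ¬?)
open import Relation.Nullary.Reflects using (Reflects; invert)
open import Relation.Unary using (Pred; Decidable)
open import Relation.Binary.Core using (Rel)
open import Relation.Binary.Definitions using (Reflexive; Symmetric; Transitive; tri<; tri≈; tri>)
open import Relation.Binary.PropositionalEquality
open import Relation.Binary.Construct.Closure.ReflexiveTransitive as Star using (Star; ε; _◅_; _◅◅_)

-- Counting inversions

indicator : ∀ {p} {P : Set p} → Dec P → ℕ
indicator (yes _) = 1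
indicator (no _)  = 0

indicator-mono : ∀ {p q} {P : Set p} {Q : Set q} (P? : Dec P) (Q? : Dec Q) →
                 (P → Q) → indicator P? ℕ.≤ indicator Q?
indicator-mono (yes p) (yes _) _   = ℕ.≤-refl
indicator-mono (yes p) (no ¬q) P→Q = ⊥-elim (¬q (P→Q p))
indicator-mono (no _)  _       _   = z≤n

indicator-< : ∀ {p q} {P : Set p} {Q : Set q} (P? : Dec P) (Q? : Dec Q) →
              ¬ P → Q → indicator P? ℕ.< indicator Q?
indicator-< (yes p) _       ¬p _ = ⊥-elim (¬p p)
indicator-< (no _)  (yes _) _  _ = s≤s z≤n
indicator-< (no _)  (no ¬q) _  q = ⊥-elim (¬q q)

length-filter≡sum-indicator : ∀ {a p} {A : Set a} {P : Pred A p} (P? : Decidable P) (xs : List A) →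
  length (filter P? xs) ≡ sum (map (indicator ∘ P?) xs)
length-filter≡sum-indicator P? []       = refl
length-filter≡sum-indicator P? (x ∷ xs) with P? x
... | yes _ = cong suc (length-filter≡sum-indicator P? xs)
... | no _  = length-filter≡sum-indicator P? xs

sum-cartesianProduct : ∀ {a b} {A : Set a} {B : Set b} (h : A × B → ℕ) (xs : List A) (ys : List B) →
  sum (map h (cartesianProduct xs ys)) ≡ sum (map (λ a → sum (map (λ b → h (a , b)) ys)) xs)
sum-cartesianProduct h []       ys = refl
sum-cartesianProduct h (x ∷ xs) ys = begin
  sum (map h (map (x ,_) ys ++ cartesianProduct xs ys))
    ≡⟨ cong sum (List.map-++ h (map (x ,_) ys) _) ⟩
  sum (map h (map (x ,_) ys) ++ map h (cartesianProduct xs ys))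
    ≡⟨ sum-++ (map h (map (x ,_) ys)) _ ⟩
  sum (map h (map (x ,_) ys)) ℕ.+ sum (map h (cartesianProduct xs ys))
    ≡⟨ cong₂ ℕ._+_ (cong sum (sym (List.map-∘ ys))) (sum-cartesianProduct h xs ys) ⟩
  sum (map (λ b → h (x , b)) ys) ℕ.+ sum (map (λ a → sum (map (λ b → h (a , b)) ys)) xs) ∎
  where open ≡-Reasoning

sum-map-tabulate : ∀ {a} {A : Set a} n (g : Fin n → A) (h : A → ℕ) →
  sum (map h (tabulate g)) ≡ ∑ (h ∘ g)
sum-map-tabulate zero    g h = refl
sum-map-tabulate (suc n) g h = cong (h (g Fin.zero) ℕ.+_) (sum-map-tabulate n (g ∘ Fin.suc) h)

∑-mono-≤ : ∀ {n} {f g : Fin n → ℕ} → (∀ a → f a ℕ.≤ g a) → ∑ f ℕ.≤ ∑ g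
∑-mono-≤ {zero}  f≤g = z≤n
∑-mono-≤ {suc n} f≤g = ℕ.+-mono-≤ (f≤g Fin.zero) (∑-mono-≤ (f≤g ∘ Fin.suc))

∑-mono-< : ∀ {n} {f g : Fin n → ℕ} → (∀ a → f a ℕ.≤ g a) →
  ∀ a → f a ℕ.< g a → ∑ f ℕ.< ∑ g
∑-mono-< f≤g Fin.zero    f<g = ℕ.+-mono-<-≤ f<g (∑-mono-≤ (f≤g ∘ Fin.suc))
∑-mono-< f≤g (Fin.suc a) f<g = ℕ.+-mono-≤-< (f≤g Fin.zero) (∑-mono-< (f≤g ∘ Fin.suc) a f<g)

IsInversion : ∀ {n} → (Fin n → Fin n) → Fin n → Fin n → Set
IsInversion f a b = a < b × f b < f a

isInversion? : ∀ {n} (f : Fin n → Fin n) (p : Fin n × Fin n) →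
  Dec (IsInversion f (proj₁ p) (proj₂ p))
isInversion? f (a , b) = (a Fin.<? b) ×-dec (f b Fin.<? f a)

inversion : ∀ {n} → (Fin n → Fin n) → Fin n → Fin n → ℕ
inversion f a b = indicator (isInversion? f (a , b))

len≡∑-inversion : ∀ {n} (f : Fin n → Fin n) → len f ≡ ∑[ a < n ] ∑[ b < n ] inversion f a b
len≡∑-inversion {n} f = begin
  len f
    ≡⟨ length-filter≡sum-indicator (isInversion? f) (cartesianProduct (allFin n) (allFin n)) ⟩
  sum (map (indicator ∘ isInversion? f) (cartesianProduct (allFin n) (allFin n)))
    ≡⟨ sum-cartesianProduct _ (allFin n) (allFin n) ⟩
  sum (map row (allFin n))
    ≡⟨ sum-map-tabulate n id row ⟩
  ∑ row
    ≡⟨ sum-cong-≗ (λ a → sum-map-tabulate n id (inversion f a)) ⟩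
  ∑[ a < n ] ∑[ b < n ] inversion f a b ∎
  where
  open ≡-Reasoning
  row : Fin n → ℕ
  row a = sum (map (inversion f a) (allFin n))

-- Descents of a permutation

<-resp-≡ : ∀ {n} {c c′ d d′ : Fin n} → c ≡ c′ → d ≡ d′ → c′ < d′ → c < d
<-resp-≡ refl refl = id

module _ {m : ℕ} (i : Fin m) where

  gen-cases : ∀ a → (a ≡ inject₁ i × gen i a ≡ Fin.suc i)
                  ⊎ (a ≡ Fin.suc i × gen i a ≡ inject₁ i)
                  ⊎ (a ≢ inject₁ i × a ≢ Fin.suc i × gen i a ≡ a)
  gen-cases a with a Fin.≟ inject₁ i
  ... | yes a≡i = inj₁ (a≡i , refl)
  ... | no a≢i with a Fin.≟ Fin.suc i
  ...   | yes a≡1+i = inj₂ (inj₁ (a≡1+i , refl))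
  ...   | no a≢1+i  = inj₂ (inj₂ (a≢i , a≢1+i , refl))

  inject₁<suc : inject₁ i < Fin.suc i
  inject₁<suc = s≤s (ℕ.≤-reflexive (Fin.toℕ-inject₁ i))

  inject₁<⇒suc≤ : ∀ {b : Fin (suc m)} → inject₁ i < b → Fin.suc i ≤ b
  inject₁<⇒suc≤ {b} = subst (λ k → suc k ℕ.≤ toℕ b) (Fin.toℕ-inject₁ i)

  <suc⇒≤inject₁ : ∀ {a : Fin (suc m)} → a < Fin.suc i → a ≤ inject₁ i
  <suc⇒≤inject₁ {a} a<1+i = subst (toℕ a ℕ.≤_) (sym (Fin.toℕ-inject₁ i)) (ℕ.≤-pred a<1+i)

  gen-inject₁ : gen i (inject₁ i) ≡ Fin.suc i
  gen-inject₁ with gen-cases (inject₁ i)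
  ... | inj₁ (_ , eq)           = eq
  ... | inj₂ (inj₁ (i≡1+i , _)) = ⊥-elim (Fin.<-irrefl i≡1+i inject₁<suc)
  ... | inj₂ (inj₂ (i≢i , _))   = ⊥-elim (i≢i refl)

  gen-suc : gen i (Fin.suc i) ≡ inject₁ i
  gen-suc with gen-cases (Fin.suc i)
  ... | inj₁ (1+i≡i , _)              = ⊥-elim (Fin.<-irrefl (sym 1+i≡i) inject₁<suc)
  ... | inj₂ (inj₁ (_ , eq))          = eq
  ... | inj₂ (inj₂ (_ , 1+i≢1+i , _)) = ⊥-elim (1+i≢1+i refl)

  gen-preserves-< : ∀ {a b : Fin (suc m)} → a < b →
    (a ≡ inject₁ i × b ≡ Fin.suc i) ⊎ gen i a < gen i b
  gen-preserves-< {a} {b} a<b with gen-cases a | gen-cases b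
  ... | inj₁ (refl , _) | inj₁ (refl , _) = ⊥-elim (Fin.<-irrefl refl a<b)
  ... | inj₁ (refl , _) | inj₂ (inj₁ (refl , _)) = inj₁ (refl , refl)
  ... | inj₁ (refl , σa) | inj₂ (inj₂ (_ , b≢1+i , σb)) =
    inj₂ (<-resp-≡ σa σb (Fin.≤∧≢⇒< (inject₁<⇒suc≤ a<b) (b≢1+i ∘ sym)))
  ... | inj₂ (inj₁ (refl , _)) | inj₁ (refl , _) = ⊥-elim (Fin.<-asym a<b inject₁<suc)
  ... | inj₂ (inj₁ (refl , _)) | inj₂ (inj₁ (refl , _)) = ⊥-elim (Fin.<-irrefl refl a<b)
  ... | inj₂ (inj₁ (refl , σa)) | inj₂ (inj₂ (_ , _ , σb)) =
    inj₂ (<-resp-≡ σa σb (Fin.<-trans inject₁<suc a<b))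
  ... | inj₂ (inj₂ (_ , _ , σa)) | inj₁ (refl , σb) =
    inj₂ (<-resp-≡ σa σb (Fin.<-trans a<b inject₁<suc))
  ... | inj₂ (inj₂ (a≢i , _ , σa)) | inj₂ (inj₁ (refl , σb)) =
    inj₂ (<-resp-≡ σa σb (Fin.≤∧≢⇒< (<suc⇒≤inject₁ a<b) a≢i))
  ... | inj₂ (inj₂ (_ , _ , σa)) | inj₂ (inj₂ (_ , _ , σb)) = inj₂ (<-resp-≡ σa σb a<b)

  -- Reindexing both sums by s_i sends each inversion of f ∘ s_i to an inversion of f,
  -- and misses the inversion (i, i+1) of f.
  len-∘gen-< : (f : Fin (suc m) → Fin (suc m)) → f (Fin.suc i) < f (inject₁ i) →
    len (f ∘ gen i) ℕ.< len f
  len-∘gen-< f descent = begin-strict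
    len (f ∘ gen i)                                             ≡⟨ len≡∑-inversion (f ∘ gen i) ⟩
    ∑[ a < suc m ] ∑[ b < suc m ] inversion (f ∘ gen i) a b
      <⟨ ∑-mono-< (λ a → ∑-mono-≤ (inversion-moves a)) (Fin.suc i)
           (∑-mono-< (inversion-moves (Fin.suc i)) (inject₁ i) descent-removed) ⟩
    ∑[ a < suc m ] ∑[ b < suc m ] inversion f (gen i a) (gen i b)
      ≡⟨ sum-cong-≗ (λ a → sum-permute (inversion f (gen i a)) σ) ⟨
    ∑[ a < suc m ] ∑[ b < suc m ] inversion f (gen i a) b
      ≡⟨ sum-permute (λ a → ∑[ b < suc m ] inversion f a b) σ ⟨
    ∑[ a < suc m ] ∑[ b < suc m ] inversion f a b               ≡⟨ len≡∑-inversion f ⟨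
    len f                                                       ∎
    where
    open ℕ.≤-Reasoning
    σ = transpose (inject₁ i) (Fin.suc i)

    inversion-moves : ∀ a b → inversion (f ∘ gen i) a b ℕ.≤ inversion f (gen i a) (gen i b)
    inversion-moves a b =
      indicator-mono (isInversion? (f ∘ gen i) (a , b)) (isInversion? f (gen i a , gen i b)) moves
      where
      moves : IsInversion (f ∘ gen i) a b → IsInversion f (gen i a) (gen i b)
      moves (a<b , fσb<fσa) with gen-preserves-< a<b
      ... | inj₂ σa<σb = σa<σb , fσb<fσa
      ... | inj₁ (refl , refl) =
        ⊥-elim (Fin.<-asym descent (subst₂ (λ u v → f u < f v) gen-suc gen-inject₁ fσb<fσa))

    descent-removed : inversion (f ∘ gen i) (Fin.suc i) (inject₁ i)
                      ℕ.< inversion f (gen i (Fin.suc i)) (gen i (inject₁ i))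
    descent-removed = indicator-< (isInversion? (f ∘ gen i) (Fin.suc i , inject₁ i))
                                  (isInversion? f (gen i (Fin.suc i) , gen i (inject₁ i)))
      (λ (1+i<i , _) → Fin.<-asym 1+i<i inject₁<suc)
      (subst₂ (IsInversion f) (sym gen-suc) (sym gen-inject₁) (inject₁<suc , descent))

Ascending : ∀ {m} → Subset m → (Fin (suc m) → Fin (suc m)) → Set
Ascending J y = ∀ i → i ∈ J → y (inject₁ i) < y (Fin.suc i)

minimal⇒ascending : ∀ {m} (J : Subset m) (x : Permutation′ (suc m)) →
  InX J x → Ascending J (x ⟨$⟩ʳ_)
minimal⇒ascending J x minimal i i∈J with Fin.<-cmp (x ⟨$⟩ʳ inject₁ i) (x ⟨$⟩ʳ Fin.suc i)
... | tri< x<x′ _ _ = x<x′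
... | tri≈ _ x≡x′ _ = ⊥-elim (Fin.<-irrefl (Injection.injective (↔⇒↣ x) x≡x′) (inject₁<suc i))
... | tri> _ _ x>x′ =
  ⊥-elim (ℕ.<⇒≱ (len-∘gen-< i (x ⟨$⟩ʳ_) x>x′) (minimal _ (stepW i i∈J idW)))

<⇒≡inject₁ : ∀ {m} {p q : Fin (suc m)} → p < q → ∃ λ j → p ≡ inject₁ j
<⇒≡inject₁ {m} {p} {q} p<q = Fin.lower₁ p m≢p , sym (Fin.inject₁-lower₁ p m≢p)
  where
  m≢p : m ≢ toℕ p
  m≢p m≡p = ℕ.<⇒≱ p<q (subst (toℕ q ℕ.≤_) m≡p (ℕ.≤-pred (Fin.toℕ<n q)))

consecutive⇒Star : ∀ {ℓ m} {R : Rel (Fin (suc m)) ℓ} {a b : Fin (suc m)} →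
  (∀ (i : Fin m) → toℕ a ℕ.≤ toℕ i → toℕ i ℕ.< toℕ b → R (inject₁ i) (Fin.suc i)) →
  a ≤ b → Star R a b
consecutive⇒Star {a = Fin.zero} {Fin.zero} step _ = ε
consecutive⇒Star {m = zero} {a = Fin.zero} {Fin.suc ()}
consecutive⇒Star {m = suc m} {a = Fin.zero} {Fin.suc b} step _ =
  step Fin.zero z≤n (s≤s z≤n)
    ◅ Star.gmap Fin.suc id
        (consecutive⇒Star (λ i _ i<b → step (Fin.suc i) z≤n (s≤s i<b)) (z≤n {toℕ b}))
consecutive⇒Star {m = suc m} {a = Fin.suc a} {Fin.suc b} step (s≤s a≤b) =
  Star.gmap Fin.suc id (consecutive⇒Star (λ i a≤i i<b → step (Fin.suc i) (s≤s a≤i) (s≤s i<b)) a≤b)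

adjacent-sym : ∀ {n} {G : Graph n} → Symmetric (Adj G)
adjacent-sym (inj₁ e) = inj₂ e
adjacent-sym (inj₂ e) = inj₁ e

connected-sym : ∀ {n} {G : Graph n} → Symmetric (Connected G)
connected-sym {G = G} = Star.reverse (adjacent-sym {G = G})

module _ {n} {G : Graph n} {C : Subset n} (C-component : IsComponent G C) {a : Fin n} (a∈C : a ∈ C) where

  component-connected : ∀ {u} → u ∈ C → Connected G a u
  component-connected {u} u∈C = let (v , _ , v~) = C-component in
    connected-sym {G = G} (proj₁ (v~ a) a∈C) ◅◅ proj₁ (v~ u) u∈C

  component-closed : ∀ {u} → Connected G a u → u ∈ C
  component-closed {u} a~u = let (v , _ , v~) = C-component in
    proj₂ (v~ u) (proj₁ (v~ a) a∈C ◅◅ a~u)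

components-≡ : ∀ {n} {G : Graph n} {C D : Subset n} → IsComponent G C → IsComponent G D →
  ∀ {v} → v ∈ C → v ∈ D → C ≡ D
components-≡ C-component D-component v∈C v∈D = ⊆-antisym
  (component-closed D-component v∈D ∘ component-connected C-component v∈C)
  (component-closed C-component v∈C ∘ component-connected D-component v∈D)

does⇒ : ∀ {p} {P : Set p} (P? : Dec P) → does P? ≡ true → P
does⇒ P? eq = invert (subst (Reflects _) eq (proof P?))

∈-tabulate⁺ : ∀ {n} (f : Fin n → Bool) {u} → f u ≡ true → u ∈ Vec.tabulate f
∈-tabulate⁺ f {u} fu≡true = lookup⇒[]= u _ (trans (lookup∘tabulate f u) fu≡true)

∈-tabulate⁻ : ∀ {n} (f : Fin n → Bool) {u} → u ∈ Vec.tabulate f → f u ≡ true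
∈-tabulate⁻ f {u} u∈ = trans (sym (lookup∘tabulate f u)) ([]=⇒lookup u∈)

∈-actS⁺ : ∀ {n} (y : Permutation′ n) {A u} → y ⟨$⟩ˡ u ∈ A → u ∈ actS y A
∈-actS⁺ y {A} y⁻¹u∈A = ∈-tabulate⁺ (λ v → Vec.lookup A (y ⟨$⟩ˡ v)) ([]=⇒lookup y⁻¹u∈A)

∈-actS⁻ : ∀ {n} (y : Permutation′ n) {A u} → u ∈ actS y A → y ⟨$⟩ˡ u ∈ A
∈-actS⁻ y {A} u∈yA = lookup⇒[]= _ A (∈-tabulate⁻ (λ v → Vec.lookup A (y ⟨$⟩ˡ v)) u∈yA)

least : ∀ {n} (A : Subset n) → Nonempty A → ∃ λ a → IsLeast a A
least (inside ∷ A)  _                       = Fin.zero , here , λ _ _ → z≤n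
least (outside ∷ A) (Fin.suc a , there a∈A) with least A (a , a∈A)
... | b , b∈A , b-least =
  Fin.suc b , there b∈A , λ where (Fin.suc c) (there c∈A) → s≤s (b-least c c∈A)

allBefore⇒leastBefore : ∀ {n} {A B : Subset n} → Nonempty A → Nonempty B →
  AllBefore A B → LeastBefore A B
allBefore⇒leastBefore {A = A} {B} A≠∅ B≠∅ A<B with least A A≠∅ | least B B≠∅
... | a , a-least | b , b-least = a , b , a-least , b-least , A<B a b (proj₁ a-least) (proj₁ b-least)

AllPairs-mapWithAll : ∀ {a p r s} {A : Set a} {P : Pred A p} {R : Rel A r} {S : Rel A s} →
  (∀ {u v} → P u → P v → R u v → S u v) → ∀ {xs} → All P xs → AllPairs R xs → AllPairs S xs
AllPairs-mapWithAll f []         []         = []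
AllPairs-mapWithAll f (pu ∷ pus) (rs ∷ rss) =
  All.zipWith (λ (pv , r) → f pu pv r) (pus , rs) ∷ AllPairs-mapWithAll f pus rss

-- The components of the graph of J are intervals

module _ {m : ℕ} (J : Subset m) where

  SameBlock : Rel (Fin (suc m)) 0ℓ
  SameBlock a b = ∀ c → c ∉ J →
    (toℕ a ℕ.≤ toℕ c → toℕ b ℕ.≤ toℕ c) × (toℕ b ℕ.≤ toℕ c → toℕ a ℕ.≤ toℕ c)

  sameBlock? : ∀ a b → Dec (SameBlock a b)
  sameBlock? a b = Fin.all? λ c → ¬? (c ∈? J) →-dec
    (((toℕ a ℕ.≤? toℕ c) →-dec (toℕ b ℕ.≤? toℕ c)) ×-dec
     ((toℕ b ℕ.≤? toℕ c) →-dec (toℕ a ℕ.≤? toℕ c)))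

  sameBlock-refl : Reflexive SameBlock
  sameBlock-refl c _ = id , id

  sameBlock-sym : Symmetric SameBlock
  sameBlock-sym a~b c c∉J = proj₂ (a~b c c∉J) , proj₁ (a~b c c∉J)

  sameBlock-trans : Transitive SameBlock
  sameBlock-trans a~b b~d c c∉J =
    proj₁ (b~d c c∉J) ∘ proj₁ (a~b c c∉J) , proj₂ (a~b c c∉J) ∘ proj₂ (b~d c c∉J)

  sameBlock-between : ∀ {a b c} → a ≤ c → c ≤ b → SameBlock a b → SameBlock a c
  sameBlock-between a≤c c≤b a~b d d∉J = (λ a≤d → ℕ.≤-trans c≤b (proj₁ (a~b d d∉J) a≤d)) , ℕ.≤-trans a≤c

  sameBlock⇒∈ : ∀ {a b} {i : Fin m} → SameBlock a b → toℕ a ℕ.≤ toℕ i → toℕ i ℕ.< toℕ b → i ∈ J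
  sameBlock⇒∈ {i = i} a~b a≤i i<b with i ∈? J
  ... | yes i∈J = i∈J
  ... | no i∉J  = ⊥-elim (ℕ.<⇒≱ i<b (proj₁ (a~b i i∉J) a≤i))

  sameBlock-edge : ∀ {i} → i ∈ J → SameBlock (inject₁ i) (Fin.suc i)
  sameBlock-edge {i} i∈J c c∉J = i≤c⇒1+i≤c , ℕ.≤-trans (ℕ.≤-reflexive (Fin.toℕ-inject₁ i)) ∘ ℕ.<⇒≤
    where
    i≤c⇒1+i≤c : toℕ (inject₁ i) ℕ.≤ toℕ c → suc (toℕ i) ℕ.≤ toℕ c
    i≤c⇒1+i≤c i≤c = ℕ.≤∧≢⇒< (subst (ℕ._≤ toℕ c) (Fin.toℕ-inject₁ i) i≤c)
                             (λ i≡c → c∉J (subst (_∈ J) (Fin.toℕ-injective i≡c) i∈J))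

  graphOf-edge : ∀ {i} → i ∈ J → graphOf J (inject₁ i) (Fin.suc i)
  graphOf-edge {i} i∈J = i , i∈J , inj₁ (refl , refl)

  adjacent⇒sameBlock : ∀ {a b} → Adj (graphOf J) a b → SameBlock a b
  adjacent⇒sameBlock (inj₁ (_ , i∈J , inj₁ (refl , refl))) = sameBlock-edge i∈J
  adjacent⇒sameBlock (inj₁ (_ , i∈J , inj₂ (refl , refl))) = sameBlock-sym (sameBlock-edge i∈J)
  adjacent⇒sameBlock (inj₂ (_ , i∈J , inj₁ (refl , refl))) = sameBlock-sym (sameBlock-edge i∈J)
  adjacent⇒sameBlock (inj₂ (_ , i∈J , inj₂ (refl , refl))) = sameBlock-edge i∈J

  connected⇒sameBlock : ∀ {a b} → Connected (graphOf J) a b → SameBlock a b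
  connected⇒sameBlock = Star.fold SameBlock (sameBlock-trans ∘ adjacent⇒sameBlock) sameBlock-refl

  sameBlock⇒connected≤ : ∀ {a b} → a ≤ b → SameBlock a b → Connected (graphOf J) a b
  sameBlock⇒connected≤ a≤b a~b =
    consecutive⇒Star (λ i a≤i i<b → inj₁ (graphOf-edge (sameBlock⇒∈ a~b a≤i i<b))) a≤b

  sameBlock⇒connected : ∀ {a b} → SameBlock a b → Connected (graphOf J) a b
  sameBlock⇒connected {a} {b} a~b with Fin.≤-total a b
  ... | inj₁ a≤b = sameBlock⇒connected≤ a≤b a~b
  ... | inj₂ b≤a = connected-sym (sameBlock⇒connected≤ b≤a (sameBlock-sym a~b))

  ascending-mono : ∀ {y} → Ascending J y → ∀ {a b} → SameBlock a b → a ≤ b → y a ≤ y b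
  ascending-mono {y} y-ascending a~b a≤b = Star.fold (λ u v → y u ≤ y v) Fin.≤-trans Fin.≤-refl
    (consecutive⇒Star (λ i a≤i i<b → ℕ.<⇒≤ (y-ascending i (sameBlock⇒∈ a~b a≤i i<b))) a≤b)

  -- y p < y (p+1) ≤ y q = y p + 1 forces y (p+1) = y q, hence p+1 = q.
  consecutive-values⇒edge : ∀ {y} → (∀ {u v} → y u ≡ y v → u ≡ v) → Ascending J y →
    ∀ {p q} → SameBlock p q → p < q → toℕ (y q) ≡ suc (toℕ (y p)) → graphOf J p q
  consecutive-values⇒edge {y} y-injective y-ascending {p} {q} p~q p<q yq≡1+yp with <⇒≡inject₁ p<q
  ... | j , refl =
    j , j∈J , inj₁ (refl , y-injective (Fin.toℕ-injective (ℕ.≤-antisym yq≤y[1+j] y[1+j]≤yq)))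
    where
    j∈J : j ∈ J
    j∈J = sameBlock⇒∈ p~q (ℕ.≤-reflexive (Fin.toℕ-inject₁ j))
                          (subst (ℕ._< toℕ q) (Fin.toℕ-inject₁ j) p<q)
    y[1+j]≤yq : y (Fin.suc j) ≤ y q
    y[1+j]≤yq = ascending-mono y-ascending (sameBlock-trans (sameBlock-sym (sameBlock-edge j∈J)) p~q)
                               (inject₁<⇒suc≤ j p<q)
    yq≤y[1+j] : y q ≤ y (Fin.suc j)
    yq≤y[1+j] = subst (ℕ._≤ toℕ (y (Fin.suc j))) (sym yq≡1+yp) (y-ascending j j∈J)

  block : Fin (suc m) → Subset (suc m)
  block a = Vec.tabulate (λ b → does (sameBlock? a b))

  ∈-block : ∀ a → a ∈ block a
  ∈-block a = ∈-tabulate⁺ (λ b → does (sameBlock? a b)) (dec-true (sameBlock? a a) sameBlock-refl)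

  block-isComponent : ∀ a → IsComponent (graphOf J) (block a)
  block-isComponent a = a , ∈-block a , λ u →
    (sameBlock⇒connected ∘ does⇒ (sameBlock? a u) ∘ ∈-tabulate⁻ inBlock) ,
    (∈-tabulate⁺ inBlock ∘ dec-true (sameBlock? a u) ∘ connected⇒sameBlock)
    where
    inBlock : Fin (suc m) → Bool
    inBlock b = does (sameBlock? a b)

  leastBefore⇒allBefore : ∀ {A B} → IsComponent (graphOf J) A → IsComponent (graphOf J) B →
    LeastBefore A B → AllBefore A B
  leastBefore⇒allBefore {A} {B} A-component B-component (a , b , (a∈A , _) , (b∈B , b-least) , a<b)
                        u w u∈A w∈B with u Fin.<? w
  ... | yes u<w = u<w
  ... | no u≮w = ⊥-elim (ℕ.<⇒≱ a<b (b-least a a∈B))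
    where
    a~b : SameBlock a b
    a~b = sameBlock-between (ℕ.<⇒≤ a<b) (ℕ.≤-trans (b-least w w∈B) (ℕ.≮⇒≥ u≮w))
            (connected⇒sameBlock (component-connected A-component a∈A u∈A))
    a∈B : a ∈ B
    a∈B = component-closed B-component b∈B (sameBlock⇒connected (sameBlock-sym a~b))

  orderedPresentation⇒allBefore : ∀ {Cs} → IsOrderedPresentation (graphOf J) Cs → AllPairs AllBefore Cs
  orderedPresentation⇒allBefore (Cs-components , _ , Cs-ordered) =
    AllPairs-mapWithAll leastBefore⇒allBefore Cs-components Cs-ordered

-- The graph x⁻¹𝒥 ∩ 𝒦

module Intersection {m : ℕ} (J K : Subset m) (x : Permutation′ (suc m))
  (x⁻¹-ascending : Ascending J (x ⟨$⟩ˡ_)) (x-ascending : Ascending K (x ⟨$⟩ʳ_)) where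

  G : Graph (suc m)
  G = actG (flip x) (graphOf J) ∩G graphOf K

  connected⇒sameBlocks : ∀ {u w} → Connected G u w →
    SameBlock K u w × SameBlock J (x ⟨$⟩ʳ u) (x ⟨$⟩ʳ w)
  connected⇒sameBlocks u~w =
    connected⇒sameBlock K (Star.map (Sum.map proj₂ proj₂) u~w) ,
    connected⇒sameBlock J (Star.gmap (x ⟨$⟩ʳ_) (Sum.map proj₁ proj₁) u~w)

  sameBlock-image : ∀ {u w c} → SameBlock K u w → SameBlock J (x ⟨$⟩ʳ u) (x ⟨$⟩ʳ w) →
    u ≤ c → c ≤ w → SameBlock J (x ⟨$⟩ʳ u) (x ⟨$⟩ʳ c)
  sameBlock-image u~w xu~xw u≤c c≤w =
    sameBlock-between J (ascending-mono K x-ascending u~c u≤c) (ascending-mono K x-ascending c~w c≤w) xu~xw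
    where
    u~c = sameBlock-between K u≤c c≤w u~w
    c~w = sameBlock-trans K (sameBlock-sym K u~c) u~w

  sameBlocks⇒connected≤ : ∀ {u w} → u ≤ w → SameBlock K u w → SameBlock J (x ⟨$⟩ʳ u) (x ⟨$⟩ʳ w) →
    Connected G u w
  sameBlocks⇒connected≤ {u} {w} u≤w u~w xu~xw = consecutive⇒Star step u≤w
    where
    step : ∀ i → toℕ u ℕ.≤ toℕ i → toℕ i ℕ.< toℕ w → Adj G (inject₁ i) (Fin.suc i)
    step i u≤i i<w = inj₁ (J-edge , graphOf-edge K i∈K)
      where
      i∈K = sameBlock⇒∈ K u~w u≤i i<w
      i≡i = Fin.toℕ-inject₁ i
      xi~x[1+i] : SameBlock J (x ⟨$⟩ʳ inject₁ i) (x ⟨$⟩ʳ Fin.suc i)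
      xi~x[1+i] = sameBlock-trans J
        (sameBlock-sym J (sameBlock-image u~w xu~xw (ℕ.≤-trans u≤i (ℕ.≤-reflexive (sym i≡i)))
                                                     (ℕ.≤-trans (ℕ.≤-reflexive i≡i) (ℕ.<⇒≤ i<w))))
        (sameBlock-image u~w xu~xw (ℕ.m≤n⇒m≤1+n u≤i) i<w)
      consecutive : toℕ (x ⟨$⟩ˡ (x ⟨$⟩ʳ Fin.suc i)) ≡ suc (toℕ (x ⟨$⟩ˡ (x ⟨$⟩ʳ inject₁ i)))
      consecutive = begin
        toℕ (x ⟨$⟩ˡ (x ⟨$⟩ʳ Fin.suc i))      ≡⟨ cong toℕ (inverseˡ x) ⟩
        suc (toℕ i)                           ≡⟨ cong suc i≡i ⟨
        suc (toℕ (inject₁ i))                 ≡⟨ cong (suc ∘ toℕ) (inverseˡ x) ⟨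
        suc (toℕ (x ⟨$⟩ˡ (x ⟨$⟩ʳ inject₁ i))) ∎
        where open ≡-Reasoning
      J-edge = consecutive-values⇒edge J (Injection.injective (↔⇒↣ (flip x))) x⁻¹-ascending
                 xi~x[1+i] (x-ascending i i∈K) consecutive

  sameBlocks⇒connected : ∀ {u w} → SameBlock K u w → SameBlock J (x ⟨$⟩ʳ u) (x ⟨$⟩ʳ w) →
    Connected G u w
  sameBlocks⇒connected {u} {w} u~w xu~xw with Fin.≤-total u w
  ... | inj₁ u≤w = sameBlocks⇒connected≤ u≤w u~w xu~xw
  ... | inj₂ w≤u =
    connected-sym {G = G} (sameBlocks⇒connected≤ w≤u (sameBlock-sym K u~w) (sameBlock-sym J xu~xw))

  meet : Subset (suc m) → Subset (suc m) → Subset (suc m)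
  meet A B = actS (flip x) A ∩ B

  ∈-meet⁺ : ∀ {A B u} → x ⟨$⟩ʳ u ∈ A → u ∈ B → u ∈ meet A B
  ∈-meet⁺ xu∈A u∈B = x∈p∩q⁺ (∈-actS⁺ (flip x) xu∈A , u∈B)

  ∈-meet⁻ : ∀ A B {u} → u ∈ meet A B → x ⟨$⟩ʳ u ∈ A × u ∈ B
  ∈-meet⁻ A B u∈A∩B =
    let (u∈xA , u∈B) = x∈p∩q⁻ (actS (flip x) A) B u∈A∩B in ∈-actS⁻ (flip x) u∈xA , u∈B

  meet-isComponent : ∀ {A B v} → IsComponent (graphOf J) A → IsComponent (graphOf K) B →
    v ∈ meet A B → IsComponent G (meet A B)
  meet-isComponent {A} {B} {v} A-component B-component v∈ = v , v∈ , λ u → connected , closed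
    where
    xv∈A = proj₁ (∈-meet⁻ A B v∈)
    v∈B = proj₂ (∈-meet⁻ A B v∈)
    connected : ∀ {u} → u ∈ meet A B → Connected G v u
    connected u∈ = let (xu∈A , u∈B) = ∈-meet⁻ A B u∈ in sameBlocks⇒connected
      (connected⇒sameBlock K (component-connected B-component v∈B u∈B))
      (connected⇒sameBlock J (component-connected A-component xv∈A xu∈A))
    closed : ∀ {u} → Connected G v u → u ∈ meet A B
    closed v~u = let (v~u-in-K , xv~xu-in-J) = connected⇒sameBlocks v~u in ∈-meet⁺
      (component-closed A-component xv∈A (sameBlock⇒connected J xv~xu-in-J))
      (component-closed B-component v∈B (sameBlock⇒connected K v~u-in-K))

  meet-allBeforeˡ : ∀ {A A′ B} → IsComponent (graphOf K) B →
    AllBefore A A′ → AllBefore (meet A B) (meet A′ B)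
  meet-allBeforeˡ {A} {A′} {B} B-component A<A′ u u′ u∈ u′∈ with u Fin.<? u′
  ... | yes u<u′ = u<u′
  ... | no u≮u′ = ⊥-elim (ℕ.<⇒≱ (A<A′ _ _ (proj₁ (∈-meet⁻ A B u∈)) (proj₁ (∈-meet⁻ A′ B u′∈)))
                                 (ascending-mono K x-ascending u′~u (ℕ.≮⇒≥ u≮u′)))
    where
    u′~u = connected⇒sameBlock K
      (component-connected B-component (proj₂ (∈-meet⁻ A′ B u′∈)) (proj₂ (∈-meet⁻ A B u∈)))

  meet-allBeforeʳ : ∀ {A A′ B B′} → AllBefore B B′ → AllBefore (meet A B) (meet A′ B′)
  meet-allBeforeʳ {A} {A′} {B} {B′} B<B′ u u′ u∈ u′∈ =
    B<B′ u u′ (proj₂ (∈-meet⁻ A B u∈)) (proj₂ (∈-meet⁻ A′ B′ u′∈))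

  row : List (Subset (suc m)) → Subset (suc m) → List (Subset (suc m))
  row As B = map (λ A → meet A B) As

  module _ (Js Ks : List (Subset (suc m))) where

    intersectionList-nonempty : All Nonempty (intersectionList x Js Ks)
    intersectionList-nonempty = All.all-filter nonempty? (List.concatMap (row Js) Ks)

    intersectionList-components : All (IsComponent (graphOf J)) Js → All (IsComponent (graphOf K)) Ks →
      All (IsComponent G) (intersectionList x Js Ks)
    intersectionList-components Js-components Ks-components =
      All.zipWith (λ (f , D≠∅) → f D≠∅) (All.filter⁺ nonempty? candidates , intersectionList-nonempty)
      where
      candidates : All (λ D → Nonempty D → IsComponent G D) (List.concatMap (row Js) Ks)
      candidates = All.concat⁺ (All.map⁺ (All.map (λ B-component → All.map⁺
        (All.map (λ A-component (_ , v∈) → meet-isComponent A-component B-component v∈) Js-components))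
        Ks-components))

    intersectionList-complete : (∀ A → IsComponent (graphOf J) A → A List.∈ Js) →
      (∀ B → IsComponent (graphOf K) B → B List.∈ Ks) →
      ∀ C → IsComponent G C → C List.∈ intersectionList x Js Ks
    intersectionList-complete Js-complete Ks-complete C C-component@(v , v∈C , _) =
      subst (List._∈ intersectionList x Js Ks) (components-≡ D-component C-component v∈D v∈C) D∈
      where
      A = block J (x ⟨$⟩ʳ v)
      B = block K v
      v∈D : v ∈ meet A B
      v∈D = ∈-meet⁺ (∈-block J (x ⟨$⟩ʳ v)) (∈-block K v)
      D-component = meet-isComponent (block-isComponent J (x ⟨$⟩ʳ v)) (block-isComponent K v) v∈D
      A∈Js = Js-complete A (block-isComponent J (x ⟨$⟩ʳ v))
      B∈Ks = Ks-complete B (block-isComponent K v)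
      D∈ : meet A B List.∈ intersectionList x Js Ks
      D∈ = List.∈-filter⁺ nonempty?
        (List.∈-concatMap⁺ (row Js)
          (Any.map (λ where refl → List.∈-map⁺ (λ A′ → meet A′ B) A∈Js) B∈Ks))
        (v , v∈D)

    intersectionList-allBefore : AllPairs AllBefore Js → All (IsComponent (graphOf K)) Ks →
      AllPairs AllBefore Ks → AllPairs AllBefore (intersectionList x Js Ks)
    intersectionList-allBefore Js-sorted Ks-components Ks-sorted =
      AllPairs.filter⁺ nonempty? (AllPairs.concat⁺ rows-sorted rows-ordered)
      where
      rows-sorted : All (AllPairs AllBefore) (map (row Js) Ks)
      rows-sorted = All.map⁺ (All.map
        (λ B-component → AllPairs.map⁺ (AllPairs.map (meet-allBeforeˡ B-component) Js-sorted))
        Ks-components)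
      rows-ordered : AllPairs (λ r r′ → All (λ D → All (AllBefore D) r′) r) (map (row Js) Ks)
      rows-ordered = AllPairs.map⁺ (AllPairs.map (λ B<B′ → All.map⁺ (All.universal (λ A →
        All.map⁺ (All.universal (λ A′ → meet-allBeforeʳ {A} {A′} B<B′) Js)) Js)) Ks-sorted)

mainTheorem1 : (m : ℕ) (J K : Subset m) (Js Ks : List (Subset (suc m))) (x : Permutation′ (suc m)) →
    IsOrderedPresentation (graphOf J) Js →
    IsOrderedPresentation (graphOf K) Ks →
    InXinv J x → InX K x →
    IsOrderedPresentation (actG (flip x) (graphOf J) ∩G graphOf K) (intersectionList x Js Ks)
      × AllPairs AllBefore (intersectionList x Js Ks)
mainTheorem1 m J K Js Ks x Js-presentation Ks-presentation x⁻¹∈X x∈X =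
  (intersectionList-components Js Ks (proj₁ Js-presentation) Ks-components ,
   intersectionList-complete Js Ks (proj₁ (proj₂ Js-presentation)) (proj₁ (proj₂ Ks-presentation)) ,
   AllPairs-mapWithAll allBefore⇒leastBefore (intersectionList-nonempty Js Ks) sorted) ,
  sorted
  where
  open Intersection J K x (minimal⇒ascending J (flip x) x⁻¹∈X) (minimal⇒ascending K x x∈X)
  Ks-components = proj₁ Ks-presentation
  sorted : AllPairs AllBefore (intersectionList x Js Ks)
  sorted = intersectionList-allBefore Js Ks (orderedPresentation⇒allBefore J Js-presentation) Ks-components
                                      (orderedPresentation⇒allBefore K Ks-presentation)
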